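{- Let $n\ge 5$ and let $S\subseteq V(C_n)$ be a nonempty set of vertices of the cycle $C_n$ which are consecutive, i.e. the elements of $S$ can be listed as $\ell_1,\dots,\ell_\sigma$ with $\ell_i$ adjacent to $\ell_{i+1}$ in $C_n$ for all $1\le i\le\sigma-1$. Then $\operatorname{rank}((C_n)_S)\neq 3$.
   Context: For a simple graph $G$ and $S\subseteq V(G)$, the self-loop graph $G_S$ is obtained from $G$ by attaching one self-loop at each vertex of $S$. Its adjacency matrix is $A(G)+D_S$, where $A(G)$ is the usual $0/1$ adjacency matrix and $D_S$ is the diagonal $0/1$ matrix with $1$'s exactly at the vertices of $S$; the rank of $G_S$ is the rank of this matrix over $\mathbb{R}$.
   Formalization: The rank of $G_S$ is taken over the rationals rather than over the reals. -}

module Defs where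

open import Data.Nat using (ℕ; zero; suc; _≡ᵇ_)
open import Data.Bool using (Bool; true; false; _∨_; _∧_; if_then_else_)
open import Data.Fin using (Fin; toℕ; zero; suc)
open import Data.Fin.Subset using (Subset; _∈_; Nonempty)
open import Data.Vec using (lookup)
open import Data.Rational using (ℚ; 0ℚ; 1ℚ; _+_; _*_)
open import Data.Product using (Σ; ∃; _×_)
open import Relation.Binary.PropositionalEquality using (_≡_)
open import Function.Definitions using (Injective)
open import Function.Bundles using (_⇔_)

Σℚ : (k : ℕ) → (Fin k → ℚ) → ℚ
Σℚ zero    f = 0ℚ
Σℚ (suc k) f = f zero + Σℚ k (λ i → f (suc i))


cycleAdj : (n : ℕ) → Fin n → Fin n → Bool
cycleAdj n i j =
  (toℕ j ≡ᵇ suc (toℕ i)) ∨ (toℕ i ≡ᵇ suc (toℕ j))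
  ∨ ((toℕ i ≡ᵇ 0) ∧ (suc (toℕ j) ≡ᵇ n))
  ∨ ((toℕ j ≡ᵇ 0) ∧ (suc (toℕ i) ≡ᵇ n))

01ℚ : Bool → ℚ
01ℚ b = if b then 1ℚ else 0ℚ

-- Adjacency matrix A(G) + D_S of the self-loop graph G_S, for G = C_n.
loopCycleMatrix : (n : ℕ) → Subset n → Fin n → Fin n → ℚ
loopCycleMatrix n S i j =
  01ℚ (cycleAdj n i j) + 01ℚ ((toℕ i ≡ᵇ toℕ j) ∧ lookup S i)

LinIndep : (m r : ℕ) → (Fin r → Fin m → ℚ) → Set
LinIndep m r v =
  (c : Fin r → ℚ) → (∀ a → Σℚ r (λ k → c k * v k a) ≡ 0ℚ) → ∀ k → c k ≡ 0ℚ

InSpan : (m r : ℕ) → (Fin r → Fin m → ℚ) → (Fin m → ℚ) → Set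
InSpan m r v w = ∃ λ (c : Fin r → ℚ) → ∀ a → Σℚ r (λ k → c k * v k a) ≡ w a

HasRank : (m n : ℕ) → (Fin m → Fin n → ℚ) → ℕ → Set
HasRank m n M r =
  ∃ λ (f : Fin r → Fin n) →
    LinIndep m r (λ k a → M a (f k)) × (∀ j → InSpan m r (λ k a → M a (f k)) (λ a → M a j))

Consecutive : (n : ℕ) → Subset n → Set
Consecutive n S =
  Σ ℕ λ σ → Σ (Fin σ → Fin n) λ ℓ →
    Injective _≡_ _≡_ ℓ
    × (∀ x → (x ∈ S) ⇔ (∃ λ i → ℓ i ≡ x))
    × (∀ (i j : Fin σ) → toℕ j ≡ suc (toℕ i) → cycleAdj n (ℓ i) (ℓ j) ≡ true)

-- If A(Cₙ) + D_S had rank 3, any four of its columns would be linearly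
-- dependent, because more than r vectors in the span of r vectors are
-- (Gaussian elimination on their coordinates). But for n ≥ 5 the columns of
-- the vertices 1, 2, 3, 4 are independent: on the rows 0, 1, 2, 3 they form a
-- 4 × 4 block that is lower unitriangular except for the corner entry x of the
-- edge {0, 4}, which exists only when n = 5, and its determinant
-- 1 + x(s₁ + s₃ − s₁s₂s₃) is positive for 0/1 entries. So the rank is at least 4
-- for every S.
module Submission where

open import Defs
open import Algebra.Bundles using (CommutativeRing)
open import Data.Bool using (true; false)
open import Data.Fin using (Fin; zero; suc; punchIn; _↑ˡ_)
open import Data.Fin.Patterns using (0F; 1F; 2F; 3F)
open import Data.Fin.Properties using (any?)
open import Data.Fin.Subset using (Subset; Nonempty)
open import Data.Nat as ℕ using (ℕ; zero; suc; _≤_; _<_; s≤s)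
open import Data.Nat.Properties using (n<1+n; m<n⇒m<1+n; m≤n⇒∃[o]m+o≡n)
open import Data.Product using (∃; _×_; _,_; proj₁; proj₂)
open import Data.Rational using (ℚ; 0ℚ; 1ℚ; _+_; _*_; -_; _-_; 1/_; ≢-nonZero)
open import Data.Rational.Properties
  using (_≟_; +-*-commutativeRing; +-identityˡ; *-identityˡ; *-zeroˡ; *-zeroʳ; *-comm; *-assoc; *-inverseˡ)
open import Data.Sum using (_⊎_; inj₁; inj₂)
open import Data.Vec using (lookup)
open import Data.Vec.Functional using (Vector; []; _∷_; insertAt)
open import Data.Vec.Functional.Properties using (insertAt-lookup; insertAt-punchIn)
open import Function using (_∘_)
open import Relation.Binary.PropositionalEquality
  using (_≡_; _≢_; refl; sym; trans; cong; cong₂; module ≡-Reasoning)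
open import Relation.Nullary using (¬_; yes; no; ¬?)
open import Relation.Nullary.Decidable using (decidable-stable; dec⇒maybe)
open import Tactic.RingSolver using (solve-∀)
open import Tactic.RingSolver.Core.AlmostCommutativeRing using (AlmostCommutativeRing; fromCommutativeRing)

open import Algebra.Properties.Semiring.Sum (CommutativeRing.semiring +-*-commutativeRing)
  using (sum; sum-syntax; sum-cong-≗; sum-replicate-zero; sum-remove; ∑-distrib-+; ∑-comm; *-distribˡ-sum; *-distribʳ-sum)

open ≡-Reasoning

ℚ-ring : AlmostCommutativeRing _ _
ℚ-ring = fromCommutativeRing +-*-commutativeRing (λ q → dec⇒maybe (0ℚ ≟ q))

Σℚ≡sum : ∀ k (f : Vector ℚ k) → Σℚ k f ≡ sum f
Σℚ≡sum zero    f = refl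
Σℚ≡sum (suc k) f = cong (f zero +_) (Σℚ≡sum k (f ∘ suc))

∑-zero : ∀ {k} {f : Vector ℚ k} → (∀ i → f i ≡ 0ℚ) → sum f ≡ 0ℚ
∑-zero {k} f≡0 = trans (sum-cong-≗ f≡0) (sum-replicate-zero k)

p≢0⇒p*q≡0⇒q≡0 : ∀ {p q} → p ≢ 0ℚ → p * q ≡ 0ℚ → q ≡ 0ℚ
p≢0⇒p*q≡0⇒q≡0 {p} {q} p≢0 pq≡0 = begin
  q               ≡⟨ sym (*-identityˡ q) ⟩
  1ℚ * q          ≡⟨ cong (_* q) (sym (*-inverseˡ p)) ⟩
  1/ p * p * q    ≡⟨ *-assoc (1/ p) p q ⟩
  1/ p * (p * q)  ≡⟨ cong (1/ p *_) pq≡0 ⟩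
  1/ p * 0ℚ       ≡⟨ *-zeroʳ (1/ p) ⟩
  0ℚ              ∎
  where instance _ = ≢-nonZero p≢0

p+q≡0∧p≡0⇒q≡0 : ∀ {p q} → p + q ≡ 0ℚ → p ≡ 0ℚ → q ≡ 0ℚ
p+q≡0∧p≡0⇒q≡0 {p} {q} p+q≡0 p≡0 = trans (sym (+-identityˡ q)) (trans (cong (_+ q) (sym p≡0)) p+q≡0)

LinDep : ∀ {r m} → (Fin r → Vector ℚ m) → Set
LinDep {r} v = ∃ λ (d : Vector ℚ r) → (∃ λ i → d i ≢ 0ℚ) × (∀ a → ∑[ i < r ] (d i * v i a) ≡ 0ℚ)

linIndep⇒¬linDep : ∀ {r m} {v : Fin r → Vector ℚ m} → LinIndep m r v → ¬ LinDep v
linIndep⇒¬linDep {r} independent (d , (i , dᵢ≢0) , vanishes) =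
  dᵢ≢0 (independent d (λ a → trans (Σℚ≡sum r _) (vanishes a)) i)

linDep-zero-head : ∀ {r m} (v : Fin r → Vector ℚ (suc m)) → (∀ i → v i zero ≡ 0ℚ) →
  LinDep (λ i a → v i (suc a)) → LinDep v
linDep-zero-head v head≡0 (d , d≢0 , vanishes) = d , d≢0 , λ where
  zero    → ∑-zero (λ i → trans (cong (d i *_) (head≡0 i)) (*-zeroʳ (d i)))
  (suc a) → vanishes a

eliminate : ∀ {r m} → Fin (suc r) → (Fin (suc r) → Vector ℚ (suc m)) → Fin r → Vector ℚ (suc m)
eliminate p v i a = v p zero * v (punchIn p i) a - v (punchIn p i) zero * v p a

eliminate-head : ∀ {r m} p (v : Fin (suc r) → Vector ℚ (suc m)) i → eliminate p v i zero ≡ 0ℚ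
eliminate-head p v i = commutator (v p zero) (v (punchIn p i) zero)
  where
  commutator : ∀ x y → x * y - y * x ≡ 0ℚ
  commutator = solve-∀ ℚ-ring

linDep-by-pivot : ∀ {r m} (v : Fin (suc r) → Vector ℚ (suc m)) p → v p zero ≢ 0ℚ →
  LinDep (λ i a → eliminate p v i (suc a)) → LinDep v
linDep-by-pivot {r} v p pivot≢0 (e , (j , eⱼ≢0) , e-vanishes) = d , (punchIn p j , dⱼ≢0) , vanishes
  where
  x = v p zero
  y : Vector ℚ r
  y i = v (punchIn p i) zero

  d : Vector ℚ (suc r)
  d = insertAt (λ i → e i * x) p (- ∑[ i < r ] (e i * y i))

  dⱼ≢0 : d (punchIn p j) ≢ 0ℚ
  dⱼ≢0 dⱼ≡0 =
    eⱼ≢0 (p≢0⇒p*q≡0⇒q≡0 pivot≢0 (trans (*-comm x (e j)) (trans (sym (insertAt-punchIn _ p _ j)) dⱼ≡0)))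

  regroup : ∀ e x w y c → e * (x * w - y * c) ≡ e * x * w + - c * (e * y)
  regroup = solve-∀ ℚ-ring

  swap : ∀ S c T → - S * c + T ≡ T + - c * S
  swap = solve-∀ ℚ-ring

  expand : ∀ a → ∑[ i < suc r ] (d i * v i a) ≡ ∑[ i < r ] (e i * eliminate p v i a)
  expand a = begin
    ∑[ i < suc r ] (d i * v i a)
      ≡⟨ sum-remove {i = p} (λ i → d i * v i a) ⟩
    d p * c + ∑[ i < r ] (d (punchIn p i) * w i)
      ≡⟨ cong₂ _+_ (cong (_* c) (insertAt-lookup _ p _)) (sum-cong-≗ λ i → cong (_* w i) (insertAt-punchIn _ p _ i)) ⟩
    - ∑[ i < r ] (e i * y i) * c + ∑[ i < r ] (e i * x * w i)
      ≡⟨ swap (∑[ i < r ] (e i * y i)) c (∑[ i < r ] (e i * x * w i)) ⟩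
    ∑[ i < r ] (e i * x * w i) + - c * ∑[ i < r ] (e i * y i)
      ≡⟨ cong (∑[ i < r ] (e i * x * w i) +_) (*-distribˡ-sum (- c) (λ i → e i * y i)) ⟩
    ∑[ i < r ] (e i * x * w i) + ∑[ i < r ] (- c * (e i * y i))
      ≡⟨ sym (∑-distrib-+ (λ i → e i * x * w i) (λ i → - c * (e i * y i))) ⟩
    ∑[ i < r ] (e i * x * w i + - c * (e i * y i))
      ≡⟨ sum-cong-≗ (λ i → sym (regroup (e i) x (w i) (y i) c)) ⟩
    ∑[ i < r ] (e i * eliminate p v i a) ∎
    where
    c = v p a
    w : Vector ℚ r
    w i = v (punchIn p i) a

  vanishes : ∀ a → ∑[ i < suc r ] (d i * v i a) ≡ 0ℚ
  vanishes zero    = trans (expand zero) (∑-zero λ i → trans (cong (e i *_) (eliminate-head p v i)) (*-zeroʳ (e i)))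
  vanishes (suc a) = trans (expand (suc a)) (e-vanishes a)

linDep-surplus : ∀ {m r} → m < r → (v : Fin r → Vector ℚ m) → LinDep v
linDep-surplus {zero}  {suc r} _ v = (λ _ → 1ℚ) , (zero , λ ()) , λ ()
linDep-surplus {suc m} {suc r} (s≤s m<r) v with any? (λ p → ¬? (v p zero ≟ 0ℚ))
... | yes (p , pivot≢0) = linDep-by-pivot v p pivot≢0 (linDep-surplus m<r (λ i a → eliminate p v i (suc a)))
... | no no-pivot       = linDep-zero-head v head≡0 (linDep-surplus (m<n⇒m<1+n m<r) (λ i a → v i (suc a)))
  where
  head≡0 : ∀ p → v p zero ≡ 0ℚ
  head≡0 p = decidable-stable (v p zero ≟ 0ℚ) (no-pivot ∘ (p ,_))

linDep-image : ∀ {r s m} {C : Fin r → Vector ℚ s} (w : Fin s → Vector ℚ m) {v : Fin r → Vector ℚ m} →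
  (∀ i a → ∑[ k < s ] (C i k * w k a) ≡ v i a) → LinDep C → LinDep v
linDep-image {r} {s} {C = C} w {v} v≡Cw (d , d≢0 , dC≡0) = d , d≢0 , vanishes
  where
  vanishes : ∀ a → ∑[ i < r ] (d i * v i a) ≡ 0ℚ
  vanishes a = begin
    ∑[ i < r ] (d i * v i a)
      ≡⟨ sum-cong-≗ (λ i → cong (d i *_) (sym (v≡Cw i a))) ⟩
    ∑[ i < r ] (d i * ∑[ k < s ] (C i k * w k a))
      ≡⟨ sum-cong-≗ (λ i → *-distribˡ-sum (d i) (λ k → C i k * w k a)) ⟩
    ∑[ i < r ] ∑[ k < s ] (d i * (C i k * w k a))
      ≡⟨ ∑-comm (λ i k → d i * (C i k * w k a)) ⟩
    ∑[ k < s ] ∑[ i < r ] (d i * (C i k * w k a))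
      ≡⟨ sum-cong-≗ (λ k → sum-cong-≗ (λ i → sym (*-assoc (d i) (C i k) (w k a)))) ⟩
    ∑[ k < s ] ∑[ i < r ] (d i * C i k * w k a)
      ≡⟨ sum-cong-≗ (λ k → sym (*-distribʳ-sum (w k a) (λ i → d i * C i k))) ⟩
    ∑[ k < s ] (∑[ i < r ] (d i * C i k) * w k a)
      ≡⟨ ∑-zero (λ k → trans (cong (_* w k a) (dC≡0 k)) (*-zeroˡ (w k a))) ⟩
    0ℚ ∎

columns-linDep : ∀ {m n r} {M : Fin m → Fin n → ℚ} → HasRank m n M r →
  (J : Fin (suc r) → Fin n) → LinDep (λ i a → M a (J i))
columns-linDep {r = r} {M} (f , _ , spanned) J =
  linDep-image {C = coordinates} (λ k a → M a (f k))
    (λ i a → trans (sym (Σℚ≡sum r _)) (proj₂ (spanned (J i)) a))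
    (linDep-surplus (n<1+n r) coordinates)
  where
  coordinates : Fin (suc r) → Vector ℚ r
  coordinates i = proj₁ (spanned (J i))

-- Rows 0–3 and columns 1–4 of A(Cₙ) + D_S, with sᵢ the loop at i and x the
-- edge {0, 4}.
block : (x s₁ s₂ s₃ : ℚ) → Fin 4 → Vector ℚ 4
block x s₁ s₂ s₃ = (1ℚ ∷ 0ℚ ∷ 0ℚ ∷ x  ∷ [])
                 ∷ (s₁ ∷ 1ℚ ∷ 0ℚ ∷ 0ℚ ∷ [])
                 ∷ (1ℚ ∷ s₂ ∷ 1ℚ ∷ 0ℚ ∷ [])
                 ∷ (0ℚ ∷ 1ℚ ∷ s₃ ∷ 1ℚ ∷ [])
                 ∷ []

block-det : (x s₁ s₂ s₃ : ℚ) → ℚ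
block-det x s₁ s₂ s₃ = 1ℚ + x * (s₁ + s₃ - s₁ * s₂ * s₃)

block-columns-linIndep : ∀ x s₁ s₂ s₃ → block-det x s₁ s₂ s₃ ≢ 0ℚ → LinIndep 4 4 (λ i a → block x s₁ s₂ s₃ a i)
block-columns-linIndep x s₁ s₂ s₃ det≢0 d rows = λ where
    0F → d₀≡0
    1F → d₁≡0
    2F → d₂≡0
    3F → d₃≡0
  where
  d₀ = d 0F
  d₁ = d 1F
  d₂ = d 2F
  d₃ = d 3F

  row₀ : ∀ x d₀ d₁ d₂ d₃ → d₀ * 1ℚ + (d₁ * 0ℚ + (d₂ * 0ℚ + (d₃ * x + 0ℚ))) ≡ x * d₃ + d₀
  row₀ = solve-∀ ℚ-ring
  row₁ : ∀ s₁ d₀ d₁ d₂ d₃ → d₀ * s₁ + (d₁ * 1ℚ + (d₂ * 0ℚ + (d₃ * 0ℚ + 0ℚ))) ≡ s₁ * d₀ + d₁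
  row₁ = solve-∀ ℚ-ring
  row₂ : ∀ s₂ d₀ d₁ d₂ d₃ → d₀ * 1ℚ + (d₁ * s₂ + (d₂ * 1ℚ + (d₃ * 0ℚ + 0ℚ))) ≡ (d₀ + s₂ * d₁) + d₂
  row₂ = solve-∀ ℚ-ring
  row₃ : ∀ s₃ d₀ d₁ d₂ d₃ → d₀ * 0ℚ + (d₁ * 1ℚ + (d₂ * s₃ + (d₃ * 1ℚ + 0ℚ))) ≡ d₁ + s₃ * d₂ + d₃
  row₃ = solve-∀ ℚ-ring

  eq₀ : x * d₃ + d₀ ≡ 0ℚ
  eq₀ = trans (sym (row₀ x d₀ d₁ d₂ d₃)) (rows 0F)
  eq₁ : s₁ * d₀ + d₁ ≡ 0ℚ
  eq₁ = trans (sym (row₁ s₁ d₀ d₁ d₂ d₃)) (rows 1F)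
  eq₂ : (d₀ + s₂ * d₁) + d₂ ≡ 0ℚ
  eq₂ = trans (sym (row₂ s₂ d₀ d₁ d₂ d₃)) (rows 2F)
  eq₃ : d₁ + s₃ * d₂ + d₃ ≡ 0ℚ
  eq₃ = trans (sym (row₃ s₃ d₀ d₁ d₂ d₃)) (rows 3F)

  -- Row 3 minus suitable multiples of the others isolates the determinant times d₃.
  cofactors : ∀ x s₁ s₂ s₃ d₀ d₁ d₂ d₃ →
    (1ℚ + x * (s₁ + s₃ - s₁ * s₂ * s₃)) * d₃
      ≡ (s₁ + s₃ - s₁ * s₂ * s₃) * (x * d₃ + d₀) - (1ℚ - s₂ * s₃) * (s₁ * d₀ + d₁)
        - s₃ * ((d₀ + s₂ * d₁) + d₂) + (d₁ + s₃ * d₂ + d₃)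
  cofactors = solve-∀ ℚ-ring

  d₃≡0 : d₃ ≡ 0ℚ
  d₃≡0 = p≢0⇒p*q≡0⇒q≡0 det≢0 (begin
    block-det x s₁ s₂ s₃ * d₃
      ≡⟨ cofactors x s₁ s₂ s₃ d₀ d₁ d₂ d₃ ⟩
    σ * (x * d₃ + d₀) - (1ℚ - s₂ * s₃) * (s₁ * d₀ + d₁)
        - s₃ * ((d₀ + s₂ * d₁) + d₂) + (d₁ + s₃ * d₂ + d₃)
      ≡⟨ cong₂ _+_ (cong₂ _-_ (cong₂ _-_ (cong (σ *_) eq₀) (cong ((1ℚ - s₂ * s₃) *_) eq₁)) (cong (s₃ *_) eq₂)) eq₃ ⟩
    σ * 0ℚ - (1ℚ - s₂ * s₃) * 0ℚ - s₃ * 0ℚ + 0ℚ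
      ≡⟨ zeros σ (1ℚ - s₂ * s₃) s₃ ⟩
    0ℚ ∎)
    where
    σ = s₁ + s₃ - s₁ * s₂ * s₃
    zeros : ∀ a b c → a * 0ℚ - b * 0ℚ - c * 0ℚ + 0ℚ ≡ 0ℚ
    zeros = solve-∀ ℚ-ring

  d₀≡0 : d₀ ≡ 0ℚ
  d₀≡0 = p+q≡0∧p≡0⇒q≡0 eq₀ (trans (cong (x *_) d₃≡0) (*-zeroʳ x))

  d₁≡0 : d₁ ≡ 0ℚ
  d₁≡0 = p+q≡0∧p≡0⇒q≡0 eq₁ (trans (cong (s₁ *_) d₀≡0) (*-zeroʳ s₁))

  d₂≡0 : d₂ ≡ 0ℚ
  d₂≡0 = p+q≡0∧p≡0⇒q≡0 eq₂ (cong₂ _+_ d₀≡0 (trans (cong (s₂ *_) d₁≡0) (*-zeroʳ s₂)))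

IsBit : ℚ → Set
IsBit q = q ≡ 0ℚ ⊎ q ≡ 1ℚ

-- For 0/1 entries s₁s₂s₃ ≤ s₁, so the determinant is at least 1.
block-det≢0 : ∀ {x s₁ s₂ s₃} → IsBit x → IsBit s₁ → IsBit s₂ → IsBit s₃ → block-det x s₁ s₂ s₃ ≢ 0ℚ
block-det≢0 {s₁ = s₁} {s₂} {s₃} (inj₁ refl) _ _ _ det≡0 =
  1≢0 (trans (sym (cong (1ℚ +_) (*-zeroˡ (s₁ + s₃ - s₁ * s₂ * s₃)))) det≡0)
  where
  1≢0 : 1ℚ ≢ 0ℚ
  1≢0 ()
block-det≢0 (inj₂ refl) (inj₁ refl) (inj₁ refl) (inj₁ refl) = λ ()
block-det≢0 (inj₂ refl) (inj₁ refl) (inj₁ refl) (inj₂ refl) = λ ()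
block-det≢0 (inj₂ refl) (inj₁ refl) (inj₂ refl) (inj₁ refl) = λ ()
block-det≢0 (inj₂ refl) (inj₁ refl) (inj₂ refl) (inj₂ refl) = λ ()
block-det≢0 (inj₂ refl) (inj₂ refl) (inj₁ refl) (inj₁ refl) = λ ()
block-det≢0 (inj₂ refl) (inj₂ refl) (inj₁ refl) (inj₂ refl) = λ ()
block-det≢0 (inj₂ refl) (inj₂ refl) (inj₂ refl) (inj₁ refl) = λ ()
block-det≢0 (inj₂ refl) (inj₂ refl) (inj₂ refl) (inj₂ refl) = λ ()

0ℚ+01ℚ-isBit : ∀ b → IsBit (0ℚ + 01ℚ b)
0ℚ+01ℚ-isBit false = inj₁ refl
0ℚ+01ℚ-isBit true  = inj₂ refl

01ℚ+0ℚ-isBit : ∀ b → IsBit (01ℚ b + 0ℚ)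
01ℚ+0ℚ-isBit false = inj₁ refl
01ℚ+0ℚ-isBit true  = inj₂ refl

module _ (k : ℕ) (S : Subset (5 ℕ.+ k)) where

  private
    M = loopCycleMatrix (5 ℕ.+ k) S

    row : Fin 4 → Fin (5 ℕ.+ k)
    row a = a ↑ˡ suc k

    col : Fin 4 → Fin (5 ℕ.+ k)
    col i = suc (i ↑ˡ k)

    x = M (row 0F) (col 3F)
    s₁ = M (row 1F) (col 0F)
    s₂ = M (row 2F) (col 1F)
    s₃ = M (row 3F) (col 2F)

  loopCycle-columns-linIndep : LinIndep (5 ℕ.+ k) 4 (λ i a → M a (col i))
  loopCycle-columns-linIndep d vanishes = block-columns-linIndep x s₁ s₂ s₃ det≢0 d restricted
    where
    det≢0 : block-det x s₁ s₂ s₃ ≢ 0ℚ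
    det≢0 = block-det≢0 (01ℚ+0ℚ-isBit (cycleAdj (5 ℕ.+ k) (row 0F) (col 3F)))
      (0ℚ+01ℚ-isBit (lookup S (row 1F))) (0ℚ+01ℚ-isBit (lookup S (row 2F))) (0ℚ+01ℚ-isBit (lookup S (row 3F)))

    restricted : ∀ a → Σℚ 4 (λ i → d i * block x s₁ s₂ s₃ a i) ≡ 0ℚ
    restricted 0F = vanishes (row 0F)
    restricted 1F = vanishes (row 1F)
    restricted 2F = vanishes (row 2F)
    restricted 3F = vanishes (row 3F)

  loopCycle-rank≢3 : ¬ HasRank (5 ℕ.+ k) (5 ℕ.+ k) M 3
  loopCycle-rank≢3 rank≡3 =
    linIndep⇒¬linDep {v = λ i a → M a (col i)} loopCycle-columns-linIndep (columns-linDep rank≡3 col)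

mainTheorem5 : (n : ℕ) → 5 ≤ n → (S : Subset n) → Nonempty S → Consecutive n S →
    ¬ HasRank n n (loopCycleMatrix n S) 3
mainTheorem5 n 5≤n S _ _ with m≤n⇒∃[o]m+o≡n 5≤n
... | k , refl = loopCycle-rank≢3 k S
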